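{- For all integers $n$ and $k$ such that $0<k \leq \lceil n/2 \rceil$, $\mathrm{rank}_{\mathrm{bin}}(D_{n,n-k}) =n$.
   Context: For integers $n \ge k \ge 0$, $D_{n,k}$ denotes the $n\times n$ circulant $0,1$ matrix whose first row consists of $n-k$ ones followed by $k$ zeros, each subsequent row being the cyclic shift of the previous row by one position to the right (so $D_{n,n-k}$ has first row with $k$ ones followed by $n-k$ zeros). The binary rank $\mathrm{rank}_{\mathrm{bin}}(A)$ is the smallest number of combinatorial rectangles (all-one submatrices indexed by a set of rows times a set of columns) that partition the ones of $A$. -}

module Defs where

open import Data.Nat using (ℕ; zero; suc; _+_; _∸_; _<_; _≤_; _<ᵇ_; _%_)
open import Data.Fin using (Fin; toℕ)
open import Data.Bool using (Bool; true; false; T)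
open import Data.Product using (Σ; ∃; _×_)
open import Relation.Binary.PropositionalEquality using (_≡_)

-- 0/1 matrices as Boolean-valued functions (true = 1, false = 0).
Matrix : ℕ → ℕ → Set
Matrix m n = Fin m → Fin n → Bool

-- D n m : the n×n circulant 0/1 matrix whose first row is (n - m) ones
-- followed by m zeros, each row the cyclic right shift of the previous.
-- Entry (i , j) is 1 iff (j - i) mod n < n - m.
D : (n m : ℕ) → Matrix n n
D zero    m ()
D (suc p) m i j = ((toℕ j + suc p ∸ toℕ i) % suc p) <ᵇ (suc p ∸ m)

record Rectangle (m n : ℕ) : Set where
  constructor rect
  field
    rows : Fin m → Bool
    cols : Fin n → Bool

_∈Rect_ : {m n : ℕ} → Fin m × Fin n → Rectangle m n → Set
_∈Rect_ (i Data.Product., j) R = T (Rectangle.rows R i) × T (Rectangle.cols R j)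

IsRectPartition : {m n : ℕ} → Matrix m n → (r : ℕ) → (Fin r → Rectangle m n) → Set
IsRectPartition {m} {n} A r F =
    (∀ (t : Fin r) (i : Fin m) (j : Fin n) → (i Data.Product., j) ∈Rect F t → A i j ≡ true)
  × (∀ (i : Fin m) (j : Fin n) → A i j ≡ true → ∃ λ (t : Fin r) → (i Data.Product., j) ∈Rect F t)
  × (∀ (i : Fin m) (j : Fin n) (t u : Fin r) →
       (i Data.Product., j) ∈Rect F t → (i Data.Product., j) ∈Rect F u → t ≡ u)

HasRectPartition : {m n : ℕ} → Matrix m n → ℕ → Set
HasRectPartition A r = Σ _ (IsRectPartition A r)

BinRankIs : {m n : ℕ} → Matrix m n → ℕ → Set
BinRankIs A r = HasRectPartition A r × (∀ s → HasRectPartition A s → r ≤ s)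

{-# OPTIONS --safe #-}
-- The n rows of D n (n ∸ k) give a partition into n rectangles, and the
-- diagonal is a fooling set: the ones (i , j) and (j , i) with i ≠ j sit at
-- cyclic offsets d and n − d, which cannot both be below k when 2k ≤ n + 1.
-- No rectangle of ones contains two diagonal cells, so every partition
-- needs at least n rectangles.
module Submission where

open import Defs
open import Data.Nat using (ℕ; _∸_; _<_; _≤_; ⌈_/2⌉; zero; suc; _+_; _%_; NonZero; z≤n; s≤s)
open import Data.Nat.Properties
open import Data.Nat.DivMod using (m<n⇒m%n≡m; [m+n]%n≡m%n; n%n≡0)
open import Data.Fin using (Fin; toℕ) renaming (_≟_ to _≟ᶠ_)
open import Data.Fin.Properties using (injective⇒≤; toℕ-injective; toℕ<n)
open import Data.Bool using (true; T)
open import Data.Bool.Properties using (T-≡)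
open import Data.Empty using (⊥; ⊥-elim)
open import Data.Product using (_×_; _,_; ∃; proj₁; proj₂)
open import Function using (id)
open import Function.Bundles using (Equivalence)
open import Relation.Nullary.Decidable using (isYes; toWitness; fromWitness)
open import Relation.Binary using (tri<; tri≈; tri>)
open import Relation.Binary.PropositionalEquality

open Equivalence using (to; from)

rowPartition : ∀ {m n} (A : Matrix m n) → HasRectPartition A m
rowPartition {m} {n} A = rowRect , allOnes , covers , disjoint
  where
  rowRect : Fin m → Rectangle m n
  rowRect t = rect (λ i → isYes (i ≟ᶠ t)) (A t)
  allOnes : ∀ t i j → (i , j) ∈Rect rowRect t → A i j ≡ true
  allOnes t i j (i≡t , tj) with toWitness i≡t
  ... | refl = to T-≡ tj
  covers : ∀ i j → A i j ≡ true → ∃ λ t → (i , j) ∈Rect rowRect t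
  covers i j Aij = i , fromWitness refl , from T-≡ Aij
  disjoint : ∀ i j t u → (i , j) ∈Rect rowRect t → (i , j) ∈Rect rowRect u → t ≡ u
  disjoint i j t u (i≡t , _) (i≡u , _) = trans (sym (toWitness i≡t)) (toWitness i≡u)

IsFoolingSet : ∀ {m n r} → Matrix m n → (Fin r → Fin m) → (Fin r → Fin n) → Set
IsFoolingSet A row col =
    (∀ t → A (row t) (col t) ≡ true)
  × (∀ t u → A (row t) (col u) ≡ true → A (row u) (col t) ≡ true → t ≡ u)

foolingSet⇒≤ : ∀ {m n r s} {A : Matrix m n} (row : Fin r → Fin m) (col : Fin r → Fin n) →
               IsFoolingSet A row col → HasRectPartition A s → r ≤ s
foolingSet⇒≤ {r = r} {s} {A} row col (ones , fooling) (F , allOnes , covers , _) =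
  injective⇒≤ rectOf-injective
  where
  rectOf : Fin r → Fin s
  rectOf t = proj₁ (covers (row t) (col t) (ones t))
  inRectOf : ∀ t → (row t , col t) ∈Rect F (rectOf t)
  inRectOf t = proj₂ (covers (row t) (col t) (ones t))
  crossIsOne : ∀ {t u} → rectOf t ≡ rectOf u → A (row t) (col u) ≡ true
  crossIsOne {t} {u} same = allOnes (rectOf t) (row t) (col u)
    (proj₁ (inRectOf t) , subst (λ v → T (Rectangle.cols (F v) (col u))) (sym same) (proj₂ (inRectOf u)))
  rectOf-injective : ∀ {t u} → rectOf t ≡ rectOf u → t ≡ u
  rectOf-injective same = fooling _ _ (crossIsOne same) (crossIsOne (sym same))

module CyclicOffset (N : ℕ) .{{_ : NonZero N}} where

  offset : ℕ → ℕ → ℕ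
  offset a b = (b + N ∸ a) % N

  offset-self : ∀ a → offset a a ≡ 0
  offset-self a = trans (cong (_% N) (m+n∸m≡n a N)) (n%n≡0 N)

  offset-< : ∀ {a b} → a < b → b < N → offset a b ≡ b ∸ a
  offset-< {a} {b} a<b b<N = begin
    (b + N ∸ a) % N  ≡⟨ cong (_% N) (+-∸-comm N (<⇒≤ a<b)) ⟩
    (b ∸ a + N) % N  ≡⟨ [m+n]%n≡m%n (b ∸ a) N ⟩
    (b ∸ a) % N      ≡⟨ m<n⇒m%n≡m (≤-<-trans (m∸n≤m b a) b<N) ⟩
    b ∸ a            ∎
    where open ≡-Reasoning

  offset-> : ∀ {a b} → a < b → b < N → offset b a ≡ N ∸ (b ∸ a)
  offset-> {a} {b} a<b b<N = begin
    (a + N ∸ b) % N              ≡⟨ cong (λ c → (a + N ∸ c) % N) (sym b≡a+d) ⟩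
    (a + N ∸ (a + (b ∸ a))) % N  ≡⟨ cong (_% N) ([m+n]∸[m+o]≡n∸o a N (b ∸ a)) ⟩
    (N ∸ (b ∸ a)) % N            ≡⟨ m<n⇒m%n≡m (∸-monoʳ-< (m<n⇒0<n∸m a<b) (≤-trans (m∸n≤m b a) (<⇒≤ b<N))) ⟩
    N ∸ (b ∸ a)                  ∎
    where
    open ≡-Reasoning
    b≡a+d : a + (b ∸ a) ≡ b
    b≡a+d = m+[n∸m]≡n (<⇒≤ a<b)

  offset-complement : ∀ {a b} → a < b → b < N → offset a b + offset b a ≡ N
  offset-complement {a} {b} a<b b<N = begin
    offset a b + offset b a  ≡⟨ cong₂ _+_ (offset-< a<b b<N) (offset-> a<b b<N) ⟩
    b ∸ a + (N ∸ (b ∸ a))    ≡⟨ m+[n∸m]≡n (≤-trans (m∸n≤m b a) (<⇒≤ b<N)) ⟩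
    N                        ∎
    where open ≡-Reasoning

  offsets-<-contradiction : ∀ {k a b} → k + k ≤ suc N → a < b → b < N →
                            offset a b < k → offset b a < k → ⊥
  offsets-<-contradiction {k} {a} {b} kk≤ a<b b<N ab<k ba<k = <-irrefl refl (begin-strict
    suc N                                <⟨ n<1+n (suc N) ⟩
    suc (suc N)                          ≡⟨ cong (λ c → suc (suc c)) (sym (offset-complement a<b b<N)) ⟩
    suc (suc (offset a b + offset b a))  ≡⟨ cong suc (sym (+-suc (offset a b) (offset b a))) ⟩
    suc (offset a b) + suc (offset b a)  ≤⟨ +-mono-≤ ab<k ba<k ⟩
    k + k                                ≤⟨ kk≤ ⟩
    suc N                                ∎)
    where open ≤-Reasoning

  offsets-<⇒≡ : ∀ {k a b} → k + k ≤ suc N → a < N → b < N →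
                offset a b < k → offset b a < k → a ≡ b
  offsets-<⇒≡ {a = a} {b} kk≤ a<N b<N ab<k ba<k with <-cmp a b
  ... | tri< a<b _ _ = ⊥-elim (offsets-<-contradiction kk≤ a<b b<N ab<k ba<k)
  ... | tri≈ _ a≡b _ = a≡b
  ... | tri> _ _ b<a = ⊥-elim (offsets-<-contradiction kk≤ b<a a<N ba<k ab<k)

⌈n/2⌉+⌈n/2⌉≤1+n : ∀ n → ⌈ n /2⌉ + ⌈ n /2⌉ ≤ suc n
⌈n/2⌉+⌈n/2⌉≤1+n zero          = z≤n
⌈n/2⌉+⌈n/2⌉≤1+n (suc zero)    = s≤s (s≤s z≤n)
⌈n/2⌉+⌈n/2⌉≤1+n (suc (suc n)) rewrite +-suc ⌈ n /2⌉ ⌈ n /2⌉ = s≤s (s≤s (⌈n/2⌉+⌈n/2⌉≤1+n n))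

module _ (p : ℕ) {k : ℕ} (k≤ : k ≤ suc p) where
  open CyclicOffset (suc p)

  private
    ones-of-D : suc p ∸ (suc p ∸ k) ≡ k
    ones-of-D = m∸[m∸n]≡n k≤

  D-true⇒offset< : ∀ i j → D (suc p) (suc p ∸ k) i j ≡ true → offset (toℕ i) (toℕ j) < k
  D-true⇒offset< i j Dij = subst (offset (toℕ i) (toℕ j) <_) ones-of-D (<ᵇ⇒< _ _ (from T-≡ Dij))

  D-diagonal : 0 < k → ∀ i → D (suc p) (suc p ∸ k) i i ≡ true
  D-diagonal 0<k i = to T-≡ (<⇒<ᵇ (subst₂ _<_ (sym (offset-self (toℕ i))) (sym ones-of-D) 0<k))

  D-diagonalFoolingSet : 0 < k → k + k ≤ suc (suc p) →
                         IsFoolingSet (D (suc p) (suc p ∸ k)) id id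
  D-diagonalFoolingSet 0<k kk≤ = D-diagonal 0<k , λ i j Dij Dji →
    toℕ-injective (offsets-<⇒≡ kk≤ (toℕ<n i) (toℕ<n j) (D-true⇒offset< i j Dij) (D-true⇒offset< j i Dji))

lemma2p2 : (n k : ℕ) → 0 < k → k ≤ ⌈ n /2⌉ → BinRankIs (D n (n ∸ k)) n
lemma2p2 zero    (suc k) _   ()
lemma2p2 (suc p) k       0<k k≤half =
  rowPartition _ , λ _ → foolingSet⇒≤ id id (D-diagonalFoolingSet p k≤n 0<k kk≤)
  where
  k≤n : k ≤ suc p
  k≤n = ≤-trans k≤half (⌈n/2⌉≤n (suc p))
  kk≤ : k + k ≤ suc (suc p)
  kk≤ = ≤-trans (+-mono-≤ k≤half k≤half) (⌈n/2⌉+⌈n/2⌉≤1+n (suc p))
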